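{- Let $\beta\in\mathfrak S_n$ and $0\le i\le n$. Then $x_{\operatorname{Sc}(1\Cup_i\beta)}=x_{\tau_S(\beta)(i)}\,x_{\operatorname{Sc}(\beta)}$, where $\tau_S(\beta)$ is the permutation of $\{0,\ldots,n\}$ defined by $\tau_S(\beta)(0)=0$ and $\tau_S(\beta)(i)=n+1-\beta(i)$ for $1\le i\le n$.
   Context: Permutations are words $\beta=\beta(1)\cdots\beta(n)$. For $\beta\in\mathfrak S_n$ and $0\le i\le n$, $1\Cup_i\beta\in\mathfrak S_{n+1}$ is obtained from $\beta$ by adding $1$ to every letter and inserting the letter $1$ at position $i+1$. $x_0,x_1,\ldots$ are commuting indeterminates, $x_c=x_{c_1}\cdots x_{c_m}$ for a sequence $c$. Saillance code: for $\sigma\in\mathfrak S_m$, $\operatorname{Sc}(\sigma)=(a_1,\ldots,a_m)$ where, if some letter greater than $j$ lies to the left of $j$ in $\sigma$ and $b$ is the rightmost such letter, $a_j=m+1-b$; otherwise $a_j=0$. -}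

module Defs where

open import Data.Nat using (ℕ; zero; suc; _∸_; _<ᵇ_)
open import Data.Bool using (Bool; true; false; not)
open import Data.List using (List; []; _∷_; map; upTo; take; drop; _++_; length; filterᵇ; takeWhileᵇ; last)
open import Data.Maybe using (Maybe; just; nothing)
open import Data.Nat using (_≡ᵇ_)

-- A permutation of {1,…,n} in one-line notation, as a word β(1)⋯β(n).
-- "β ∈ 𝔖ₙ" is expressed as  β ↭ oneTo n  (β is a rearrangement of 1,…,n).
oneTo : ℕ → List ℕ
oneTo n = map suc (upTo n)

-- 1 ⋓ᵢ β : add 1 to every letter of β and insert the letter 1 at position i+1.
insertOne : ℕ → List ℕ → List ℕ
insertOne i β = take i (map suc β) ++ (1 ∷ drop i (map suc β))

scEntry : List ℕ → ℕ → ℕ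
scEntry σ j with last (filterᵇ (λ a → j <ᵇ a) (takeWhileᵇ (λ a → not (a ≡ᵇ j)) σ))
... | just b  = suc (length σ) ∸ b
... | nothing = 0

Sc : List ℕ → List ℕ
Sc σ = map (scEntry σ) (oneTo (length σ))

-- The k-th letter β(k) (1-indexed); default 0 outside the range (never used).
letterAt : List ℕ → ℕ → ℕ
letterAt [] _ = 0
letterAt (a ∷ β) 1 = a
letterAt (a ∷ β) (suc (suc k)) = letterAt β (suc k)
letterAt (a ∷ β) 0 = 0

tauS : ℕ → List ℕ → ℕ → ℕ
tauS n β zero = 0
tauS n β (suc k) = suc n ∸ letterAt β (suc k)

module Submission where

open import Defs
open import Data.Nat using (ℕ; _≤_)
open import Data.List using (List; _∷_)
open import Data.List.Relation.Binary.Permutation.Propositional using (_↭_; ↭-reflexive)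
open import Data.Nat using (zero; suc; _<_; _∸_; _<ᵇ_; _≡ᵇ_; s≤s; z≤n)
open import Data.Bool using (true; false; not)
open import Data.List using ([]; map; upTo; take; drop; _++_; length; filterᵇ; takeWhileᵇ; last)
open import Data.List.Properties
  using (map-applyUpTo; map-∘; map-cong; take++drop≡id; length-map; length-++-sucʳ; last-map; length-upTo)
open import Data.List.Membership.Propositional.Properties using (∈-map⁻)
open import Data.List.Relation.Binary.Permutation.Propositional.Properties
  using (∈-resp-↭; ↭-length)
open import Data.List.Relation.Unary.All as All using (All; _∷_)
open import Data.Maybe using (Maybe; just; nothing)
import Data.Maybe as Maybe
open import Data.Product using (_,_)
open import Function using (_∘_; case_of_)
open import Relation.Binary.PropositionalEquality
  using (_≡_; refl; sym; trans; cong; cong₂; module ≡-Reasoning)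

-- Shifting β up and inserting 1 leaves, for every j ≥ 1, the letters greater than
-- j + 1 to the left of j + 1 equal to the shifted letters greater than j to the
-- left of j in β (the new letter 1 is too small to count), while the length
-- grows by one; so entry j + 1 of the new code is entry j of Sc β. The letter 1
-- itself is preceded by exactly the first i shifted letters, all of them larger,
-- the rightmost being β(i) + 1; this gives the entry n + 1 − β(i), or 0 if i = 0.
-- So the two codes are even equal as sequences.

leftGreater : List ℕ → ℕ → List ℕ
leftGreater σ j = filterᵇ (j <ᵇ_) (takeWhileᵇ (λ a → not (a ≡ᵇ j)) σ)

codeEntry : ℕ → Maybe ℕ → ℕ
codeEntry m (just b) = suc m ∸ b
codeEntry m nothing  = 0

scEntry≡codeEntry : ∀ σ j → scEntry σ j ≡ codeEntry (length σ) (last (leftGreater σ j))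
scEntry≡codeEntry σ j with last (leftGreater σ j)
... | just b  = refl
... | nothing = refl

codeEntry-suc : ∀ m b → codeEntry (suc m) (Maybe.map suc b) ≡ codeEntry m b
codeEntry-suc m (just b) = refl
codeEntry-suc m nothing  = refl

leftGreater-map-suc : ∀ β j → leftGreater (map suc β) (suc j) ≡ map suc (leftGreater β j)
leftGreater-map-suc []      j = refl
leftGreater-map-suc (b ∷ β) j with b ≡ᵇ j
... | true  = refl
... | false with j <ᵇ b
...   | true  = cong (suc b ∷_) (leftGreater-map-suc β j)
...   | false = leftGreater-map-suc β j

leftGreater-++-1∷ : ∀ xs ys j →
  leftGreater (xs ++ 1 ∷ ys) (suc (suc j)) ≡ leftGreater (xs ++ ys) (suc (suc j))
leftGreater-++-1∷ []       ys j = refl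
leftGreater-++-1∷ (x ∷ xs) ys j with x ≡ᵇ suc (suc j)
... | true  = refl
... | false with suc (suc j) <ᵇ x
...   | true  = cong (x ∷_) (leftGreater-++-1∷ xs ys j)
...   | false = leftGreater-++-1∷ xs ys j

length-insertOne : ∀ i β → length (insertOne i β) ≡ suc (length β)
length-insertOne i β = begin
  length (take i β′ ++ 1 ∷ drop i β′)  ≡⟨ length-++-sucʳ (take i β′) 1 (drop i β′) ⟩
  suc (length (take i β′ ++ drop i β′)) ≡⟨ cong (suc ∘ length) (take++drop≡id i β′) ⟩
  suc (length β′)                       ≡⟨ cong suc (length-map suc β) ⟩
  suc (length β)                        ∎
  where
  open ≡-Reasoning
  β′ = map suc β

scEntry-insertOne-suc : ∀ i β j → scEntry (insertOne i β) (suc (suc j)) ≡ scEntry β (suc j)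
scEntry-insertOne-suc i β j = begin
  scEntry (insertOne i β) (suc (suc j))
    ≡⟨ scEntry≡codeEntry (insertOne i β) (suc (suc j)) ⟩
  codeEntry (length (insertOne i β)) (last (leftGreater (insertOne i β) (suc (suc j))))
    ≡⟨ cong₂ codeEntry (length-insertOne i β) (cong last leftGreater-insertOne) ⟩
  codeEntry (suc (length β)) (last (map suc (leftGreater β (suc j))))
    ≡⟨ cong (codeEntry (suc (length β))) (last-map suc (leftGreater β (suc j))) ⟩
  codeEntry (suc (length β)) (Maybe.map suc (last (leftGreater β (suc j))))
    ≡⟨ codeEntry-suc (length β) (last (leftGreater β (suc j))) ⟩
  codeEntry (length β) (last (leftGreater β (suc j)))
    ≡⟨ sym (scEntry≡codeEntry β (suc j)) ⟩
  scEntry β (suc j) ∎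
  where
  open ≡-Reasoning
  β′ = map suc β
  leftGreater-insertOne : leftGreater (insertOne i β) (suc (suc j)) ≡ map suc (leftGreater β (suc j))
  leftGreater-insertOne = begin
    leftGreater (take i β′ ++ 1 ∷ drop i β′) (suc (suc j))
      ≡⟨ leftGreater-++-1∷ (take i β′) (drop i β′) j ⟩
    leftGreater (take i β′ ++ drop i β′) (suc (suc j))
      ≡⟨ cong (λ σ → leftGreater σ (suc (suc j))) (take++drop≡id i β′) ⟩
    leftGreater β′ (suc (suc j))
      ≡⟨ leftGreater-map-suc β (suc j) ⟩
    map suc (leftGreater β (suc j)) ∎

leftGreater-insertOne-1 : ∀ i β → All (0 <_) β → i ≤ length β →
  leftGreater (insertOne i β) 1 ≡ take i (map suc β)
leftGreater-insertOne-1 zero    β           _              _         = refl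
leftGreater-insertOne-1 (suc i) (suc b ∷ β) (s≤s z≤n ∷ β⁺) (s≤s i≤n) =
  cong (suc (suc b) ∷_) (leftGreater-insertOne-1 i β β⁺ i≤n)

last-take-map-suc : ∀ k β → suc k ≤ length β →
  last (take (suc k) (map suc β)) ≡ just (suc (letterAt β (suc k)))
last-take-map-suc zero    (b ∷ β)      _         = refl
last-take-map-suc (suc k) (b ∷ b′ ∷ β) (s≤s k<n) = last-take-map-suc k (b′ ∷ β) k<n

scEntry-insertOne-1 : ∀ i β → All (0 <_) β → i ≤ length β →
  scEntry (insertOne i β) 1 ≡ tauS (length β) β i
scEntry-insertOne-1 i β β⁺ i≤n
  rewrite scEntry≡codeEntry (insertOne i β) 1
        | leftGreater-insertOne-1 i β β⁺ i≤n
        | length-insertOne i β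
  with i
... | zero  = refl
... | suc k rewrite last-take-map-suc k β i≤n = refl

oneTo-suc : ∀ m → oneTo (suc m) ≡ 1 ∷ map suc (oneTo m)
oneTo-suc m = cong (1 ∷_) (cong (map suc) (sym (map-applyUpTo (λ k → k) suc m)))

map-scEntry-insertOne-suc : ∀ i β m →
  map (scEntry (insertOne i β)) (map suc (oneTo m)) ≡ map (scEntry β) (oneTo m)
map-scEntry-insertOne-suc i β m = begin
  map (scEntry (insertOne i β)) (map suc (map suc (upTo m)))
    ≡⟨ sym (trans (map-∘ (upTo m)) (map-∘ (map suc (upTo m)))) ⟩
  map (scEntry (insertOne i β) ∘ suc ∘ suc) (upTo m)
    ≡⟨ map-cong (scEntry-insertOne-suc i β) (upTo m) ⟩
  map (scEntry β ∘ suc) (upTo m)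
    ≡⟨ map-∘ (upTo m) ⟩
  map (scEntry β) (map suc (upTo m)) ∎
  where open ≡-Reasoning

Sc-insertOne : ∀ n i β → length β ≡ n → All (0 <_) β → i ≤ n →
  Sc (insertOne i β) ≡ tauS n β i ∷ Sc β
Sc-insertOne _ i β refl β⁺ i≤n = begin
  map (scEntry σ) (oneTo (length σ))
    ≡⟨ cong (map (scEntry σ) ∘ oneTo) (length-insertOne i β) ⟩
  map (scEntry σ) (oneTo (suc (length β)))
    ≡⟨ cong (map (scEntry σ)) (oneTo-suc (length β)) ⟩
  scEntry σ 1 ∷ map (scEntry σ) (map suc (oneTo (length β)))
    ≡⟨ cong₂ _∷_ (scEntry-insertOne-1 i β β⁺ i≤n) (map-scEntry-insertOne-suc i β (length β)) ⟩
  tauS (length β) β i ∷ Sc β ∎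
  where
  open ≡-Reasoning
  σ = insertOne i β

↭-oneTo-length : ∀ {n β} → β ↭ oneTo n → length β ≡ n
↭-oneTo-length {n} β↭ = trans (↭-length β↭) (trans (length-map suc (upTo n)) (length-upTo n))

↭-oneTo-positive : ∀ {n β} → β ↭ oneTo n → All (0 <_) β
↭-oneTo-positive {n} β↭ = All.tabulate λ j∈ → case ∈-map⁻ suc (∈-resp-↭ β↭ j∈) of λ where
  (_ , _ , refl) → s≤s z≤n

mainTheorem8 : (n : ℕ) (β : List ℕ) → β ↭ oneTo n →
                 (i : ℕ) → i ≤ n →
                 Sc (insertOne i β) ↭ (tauS n β i ∷ Sc β)
mainTheorem8 n β β↭ i i≤n =
  ↭-reflexive (Sc-insertOne n i β (↭-oneTo-length β↭) (↭-oneTo-positive β↭) i≤n)
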